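{- Let $T=(V,E)$ and $T'=(V,E')$ be two tournaments on the same set $V$ of $v$ vertices. Let $p$ be a prime number and $k$ an integer with $2\leq k\leq v-2$. Let $G:=T\dot{+}T'$. Assume that for all $k$-element subsets $K$ of $V$, $e(G_{\restriction K})\equiv 0 \pmod p$. 1) If $p\geq 3$ and $k\not\equiv 0,1\pmod p$, then $T'=T$. 2) If $p\geq 3$ and $k\equiv 0 \pmod p$, then $T'=T$ or $T'=T^*$. 3) If $p=2$ and $k\equiv 2\pmod 4$, then $T'=T$. 4) If $p=2$ and $k\equiv 0 \pmod 4$, then $T'=T$ or $T'=T^*$.
   Context: A tournament $T=(V,E)$ has, for every two distinct vertices $x,y$, exactly one of $(x,y),(y,x)$ in $E$. The dual $T^*$ is $(V,E^*)$ with $(x,y)\in E^*$ iff $(y,x)\in E$. The boolean sum $T\dot{+}T'$ of tournaments $T=(V,E)$, $T'=(V,E')$ is the graph on $V$ whose edges are the pairs $\{x,y\}$ such that $(x,y)\in E$ iff $(x,y)\notin E'$. For a graph $G$, $G_{\restriction K}$ is the induced subgraph on $K$ and $e(\cdot)$ counts edges. -}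

module Defs where

open import Data.Bool using (Bool; true; false; not; _xor_; _∧_)
open import Data.Nat using (ℕ; zero; suc; _+_)
open import Data.Fin using (Fin; _<_; toℕ)
open import Data.Fin.Subset using (Subset; _∈_)
open import Data.List using (List; length; filterᵇ; allFin; concatMap; map)
open import Data.Product using (_×_; _,_)
open import Relation.Binary.PropositionalEquality using (_≡_; _≢_)
open import Relation.Nullary using (¬_; Dec; yes; no; does)
open import Data.Fin using (_<?_)
open import Data.Vec using (lookup)

record Tournament (v : ℕ) : Set where
  field
    arc        : Fin v → Fin v → Bool
    irreflexive : ∀ x → arc x x ≡ false
    tournament : ∀ x y → x ≢ y → arc x y ≡ not (arc y x)
open Tournament public

_≈T_ : ∀ {v} → Tournament v → Tournament v → Set
T ≈T T' = ∀ x y → arc T x y ≡ arc T' x y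

dualArc : ∀ {v} → Tournament v → Fin v → Fin v → Bool
dualArc T x y = arc T y x

IsDualOf : ∀ {v} → Tournament v → Tournament v → Set
IsDualOf T' T = ∀ x y → arc T' x y ≡ dualArc T x y

-- boolean sum T ∔ T' : a (simple) graph on Fin v; {x,y} (x ≠ y) is an edge
-- iff ((x,y) ∈ E  iff  (x,y) ∉ E'), i.e. arc T x y ≠ arc T' x y.
boolSumAdj : ∀ {v} → Tournament v → Tournament v → Fin v → Fin v → Bool
boolSumAdj T T' x y = arc T x y xor arc T' x y

memb : ∀ {v} → Subset v → Fin v → Bool
memb K x = lookup K x

-- the unordered pairs {x,y} (represented with x < y, in the order of Fin)
-- of vertices of K that are edges of the graph with adjacency G
isEdgeIn : ∀ {v} → (Fin v → Fin v → Bool) → Subset v → Fin v × Fin v → Bool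
isEdgeIn G K (x , y) = does (x <? y) ∧ memb K x ∧ memb K y ∧ G x y

edgesIn : ∀ {v} → (Fin v → Fin v → Bool) → Subset v → List (Fin v × Fin v)
edgesIn {v} G K =
  filterᵇ (isEdgeIn G K) (concatMap (λ x → map (λ y → (x , y)) (allFin v)) (allFin v))

e↾ : ∀ {v} → (Fin v → Fin v → Bool) → Subset v → ℕ
e↾ G K = length (edgesIn G K)

module Submission where

-- Completing a (k-2)-set avoiding x, y, a, b by two of
--     these points gives G(x,a) + G(y,b) ≡ G(y,a) + G(x,b) (mod p).
--   * No split.  If a is adjacent to x but not to y, the congruence makes
--     every other vertex adjacent to exactly one of x, y; completing a
--     (k-1)-set by x, resp. y, then forces p ∣ k - 1.  So when p ∤ k - 1
--     (true in all four cases) G is constant: empty or complete.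
--   * Conclusion.  Empty means T' = T and complete means T' = T*; in
--     cases 1) and 3) completeness contradicts p ∣ k(k-1)/2.
-- The sections below follow this order, after preliminaries on finite
-- sums and subsets of Fin n; the theorem comes last.

open import Defs
open import Data.Nat using (ℕ; _≤_; _∸_; _%_)
open import Data.Nat.Primality using (Prime)
open import Data.Nat.Divisibility using (_∣_)
open import Data.Fin.Subset using (Subset; ∣_∣)
open import Data.Product using (_×_)
open import Data.Sum using (_⊎_)
open import Relation.Binary.PropositionalEquality using (_≡_)
open import Relation.Nullary using (¬_)

open import Data.Bool using (Bool; true; false; _∧_; _∨_; _xor_)
open import Data.Bool.Properties using (∨-identityʳ; ∧-zeroʳ; xor-annihilates-not; xor-identityʳ; xor-comm)
open import Data.Empty using (⊥; ⊥-elim)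
open import Data.Fin using (Fin; zero; suc; _<?_)
open import Data.Fin.Properties using (_≟_; <-cmp)
open import Data.Fin.Subset using (_∈_; _∪_; ⁅_⁆) renaming (⊥ to ∅)
open import Data.Fin.Subset.Properties using (∣⁅x⁆∣≡1; ∣⊥∣≡0; ∣p∣≤∣x∷p∣; x∈⁅x⁆; x∈p∪q⁺)
open import Data.List using (List; _∷_; length; allFin; filterᵇ; concatMap; map; tabulate; _++_)
open import Data.List.Properties using (length-++; filter-++)
open import Data.Nat using (zero; suc; _+_; _*_; _/_; z≤n; s≤s; nonTrivial⇒≢1)
open import Data.Nat.DivMod using (m≡m%n+[m/n]*n; m∣n⇒o%n%m≡o%m)
open import Data.Nat.Divisibility
  using (divides; ∣m∣n⇒∣m+n; ∣m+n∣m⇒∣n; n∣m*n; ∣⇒≤; ∣1⇒≡1; m%n≡0⇒n∣m)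
open import Data.Nat.Primality using (euclidsLemma; prime⇒nonTrivial; ¬prime[0]; ¬prime[1]; prime[2])
open import Data.Nat.Properties
  using (+-identityʳ; *-identityˡ; *-identityʳ; *-zeroʳ; +-comm; +-assoc; +-suc; *-comm;
         *-distribʳ-+; *-distribˡ-+; *-cancelˡ-≡; suc-injective; ≤-trans; ≤-reflexive; ≤-pred;
         +-monoʳ-≤; +-monoˡ-≤; +-mono-≤; n≤1+n; m≤n+m; +-*-semiring)
open import Algebra.Properties.Semiring.Sum +-*-semiring
  using (sum; ∑-distrib-+; ∑-comm; sum-cong-≗; sum-replicate-zero; *-distribˡ-sum; *-distribʳ-sum)
open import Data.Nat.Tactic.RingSolver using (solve-∀)
open import Data.Product using (_,_; ∃; proj₁; proj₂)
open import Data.Sum using (inj₁; inj₂; [_,_]′; map₁; map₂)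
open import Data.Vec using ([]; _∷_; lookup; here; there)
open import Data.Vec.Properties using (lookup-zipWith; lookup-replicate)
open import Function using (id)
open import Relation.Binary.Definitions using (tri<; tri≈; tri>)
open import Relation.Binary.PropositionalEquality
  using (_≢_; ≢-sym; refl; sym; trans; cong; cong₂; subst; subst₂; module ≡-Reasoning)
open import Relation.Nullary using (yes; no; does)
open import Relation.Nullary.Decidable using (dec-true; dec-false)

⟦_⟧ : Bool → ℕ
⟦ true ⟧ = 1
⟦ false ⟧ = 0

⟦∧⟧ : ∀ a b → ⟦ a ∧ b ⟧ ≡ ⟦ a ⟧ * ⟦ b ⟧
⟦∧⟧ true b = sym (+-identityʳ ⟦ b ⟧)
⟦∧⟧ false b = refl

∑-zero : ∀ {n} (f : Fin n → ℕ) → (∀ i → f i ≡ 0) → sum f ≡ 0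
∑-zero {n} f f≡0 = trans (sum-cong-≗ f≡0) (sum-replicate-zero n)

count-map : ∀ {a b} {A : Set a} {B : Set b} {n} (g : Fin n → B) (f : B → A) (P : A → Bool) →
  length (filterᵇ P (map f (tabulate g))) ≡ sum (λ i → ⟦ P (f (g i)) ⟧)
count-map {n = zero} g f P = refl
count-map {n = suc n} g f P with P (f (g zero))
... | true = cong suc (count-map (λ i → g (suc i)) f P)
... | false = count-map (λ i → g (suc i)) f P

count-concatMap : ∀ {a b} {A : Set a} {B : Set b} {n} (g : Fin n → B) (f : B → List A) (P : A → Bool) →
  length (filterᵇ P (concatMap f (tabulate g))) ≡ sum (λ i → length (filterᵇ P (f (g i))))
count-concatMap {n = zero} g f P = refl
count-concatMap {n = suc n} g f P = begin
  length (filterᵇ P (f (g zero) ++ rest))           ≡⟨ cong length (filter-++ _ (f (g zero)) rest) ⟩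
  length (filterᵇ P (f (g zero)) ++ filterᵇ P rest) ≡⟨ length-++ (filterᵇ P (f (g zero))) ⟩
  length (filterᵇ P (f (g zero))) + length (filterᵇ P rest)
    ≡⟨ cong (length (filterᵇ P (f (g zero))) +_) (count-concatMap (λ i → g (suc i)) f P) ⟩
  sum (λ i → length (filterᵇ P (f (g i)))) ∎
  where
  open ≡-Reasoning
  rest = concatMap f (tabulate (λ i → g (suc i)))

𝟙 : ∀ {n} → Subset n → Fin n → ℕ
𝟙 K x = ⟦ lookup K x ⟧

∣∣-as-sum : ∀ {n} (K : Subset n) → ∣ K ∣ ≡ sum (𝟙 K)
∣∣-as-sum [] = refl
∣∣-as-sum (true ∷ K) = cong suc (∣∣-as-sum K)
∣∣-as-sum (false ∷ K) = ∣∣-as-sum K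

∑-over : ∀ {n} (K : Subset n) (f : Fin n → ℕ) c → (∀ s → lookup K s ≡ true → f s ≡ c) →
  sum (λ s → 𝟙 K s * f s) ≡ ∣ K ∣ * c
∑-over K f c const = begin
  sum (λ s → 𝟙 K s * f s) ≡⟨ sum-cong-≗ onK ⟩
  sum (λ s → 𝟙 K s * c)   ≡⟨ *-distribʳ-sum c (𝟙 K) ⟨
  sum (𝟙 K) * c           ≡⟨ cong (_* c) (∣∣-as-sum K) ⟨
  ∣ K ∣ * c ∎
  where
  open ≡-Reasoning
  onK : ∀ s → 𝟙 K s * f s ≡ 𝟙 K s * c
  onK s with lookup K s in s∈K
  ... | true = cong (_+ 0) (const s s∈K)
  ... | false = refl

lookup-⁅⁆ : ∀ {n} (w y : Fin n) → lookup ⁅ w ⁆ y ≡ does (y ≟ w)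
lookup-⁅⁆ zero zero = refl
lookup-⁅⁆ zero (suc y) = lookup-replicate y false
lookup-⁅⁆ (suc w) zero = refl
lookup-⁅⁆ (suc w) (suc y) = lookup-⁅⁆ w y

⁅⁆-other : ∀ {n} {w y : Fin n} → y ≢ w → lookup ⁅ w ⁆ y ≡ false
⁅⁆-other {w = w} {y} y≢w = trans (lookup-⁅⁆ w y) (dec-false (y ≟ w) y≢w)

∑-point : ∀ {n} (w : Fin n) (f : Fin n → ℕ) → sum (λ y → 𝟙 ⁅ w ⁆ y * f y) ≡ f w
∑-point zero f = trans (cong₂ _+_ (*-identityˡ (f zero)) rest≡0) (+-identityʳ (f zero))
  where
  rest≡0 : sum (λ y → 𝟙 ∅ y * f (suc y)) ≡ 0
  rest≡0 = ∑-zero _ (λ y → cong (λ b → ⟦ b ⟧ * f (suc y)) (lookup-replicate y false))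
∑-point (suc w) f = ∑-point w (λ y → f (suc y))

𝟙-∪⁅⁆ : ∀ {n} (K : Subset n) {w} → lookup K w ≡ false →
  ∀ y → 𝟙 (K ∪ ⁅ w ⁆) y ≡ 𝟙 K y + 𝟙 ⁅ w ⁆ y
𝟙-∪⁅⁆ K {w} w∉K y rewrite lookup-zipWith _∨_ y K ⁅ w ⁆ | lookup-⁅⁆ w y with y ≟ w
... | yes refl rewrite w∉K = refl
... | no _ rewrite ∨-identityʳ (lookup K y) = sym (+-identityʳ _)

∑-∪⁅⁆ : ∀ {n} (K : Subset n) {w} → lookup K w ≡ false → (f : Fin n → ℕ) →
  sum (λ y → 𝟙 (K ∪ ⁅ w ⁆) y * f y) ≡ sum (λ y → 𝟙 K y * f y) + f w
∑-∪⁅⁆ K {w} w∉K f = begin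
  sum (λ y → 𝟙 (K ∪ ⁅ w ⁆) y * f y)
    ≡⟨ sum-cong-≗ (λ y → trans (cong (_* f y) (𝟙-∪⁅⁆ K w∉K y)) (*-distribʳ-+ (f y) (𝟙 K y) _)) ⟩
  sum (λ y → 𝟙 K y * f y + 𝟙 ⁅ w ⁆ y * f y)
    ≡⟨ ∑-distrib-+ (λ y → 𝟙 K y * f y) (λ y → 𝟙 ⁅ w ⁆ y * f y) ⟩
  sum (λ y → 𝟙 K y * f y) + sum (λ y → 𝟙 ⁅ w ⁆ y * f y)
    ≡⟨ cong (sum (λ y → 𝟙 K y * f y) +_) (∑-point w f) ⟩
  sum (λ y → 𝟙 K y * f y) + f w ∎
  where open ≡-Reasoning

∉-∪⁅⁆ : ∀ {n} (R : Subset n) {u w} → lookup R w ≡ false → w ≢ u → lookup (R ∪ ⁅ u ⁆) w ≡ false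
∉-∪⁅⁆ R {u} {w} w∉R w≢u rewrite lookup-zipWith _∨_ w R ⁅ u ⁆ | w∉R = ⁅⁆-other w≢u

∣∪⁅⁆∣ : ∀ {n} (K : Subset n) {w} → lookup K w ≡ false → ∣ K ∪ ⁅ w ⁆ ∣ ≡ suc ∣ K ∣
∣∪⁅⁆∣ K {w} w∉K = begin
  ∣ K ∪ ⁅ w ⁆ ∣                      ≡⟨ ∣∣-as-sum (K ∪ ⁅ w ⁆) ⟩
  sum (𝟙 (K ∪ ⁅ w ⁆))                ≡⟨ sum-cong-≗ (𝟙-∪⁅⁆ K w∉K) ⟩
  sum (λ y → 𝟙 K y + 𝟙 ⁅ w ⁆ y)      ≡⟨ ∑-distrib-+ (𝟙 K) (𝟙 ⁅ w ⁆) ⟩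
  sum (𝟙 K) + sum (𝟙 ⁅ w ⁆)          ≡⟨ cong₂ _+_ (∣∣-as-sum K) (∣∣-as-sum ⁅ w ⁆) ⟨
  ∣ K ∣ + ∣ ⁅ w ⁆ ∣                  ≡⟨ cong (∣ K ∣ +_) (∣⁅x⁆∣≡1 w) ⟩
  ∣ K ∣ + 1                          ≡⟨ +-comm ∣ K ∣ 1 ⟩
  suc ∣ K ∣ ∎
  where open ≡-Reasoning

∣∪∣≤ : ∀ {n} (p q : Subset n) → ∣ p ∪ q ∣ ≤ ∣ p ∣ + ∣ q ∣
∣∪∣≤ [] [] = z≤n
∣∪∣≤ (true ∷ p) (s ∷ q) = s≤s (≤-trans (∣∪∣≤ p q) (+-monoʳ-≤ ∣ p ∣ (∣p∣≤∣x∷p∣ s q)))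
∣∪∣≤ (false ∷ p) (true ∷ q) = ≤-trans (s≤s (∣∪∣≤ p q)) (≤-reflexive (sym (+-suc ∣ p ∣ ∣ q ∣)))
∣∪∣≤ (false ∷ p) (false ∷ q) = ∣∪∣≤ p q

∣⁅x,y⁆∣≤2 : ∀ {n} (x y : Fin n) → ∣ ⁅ x ⁆ ∪ ⁅ y ⁆ ∣ ≤ 2
∣⁅x,y⁆∣≤2 x y = ≤-trans (∣∪∣≤ ⁅ x ⁆ ⁅ y ⁆) (≤-reflexive (cong₂ _+_ (∣⁅x⁆∣≡1 x) (∣⁅x⁆∣≡1 y)))

Avoiding : ∀ {n} → Subset n → ℕ → Set
Avoiding F m = ∃ λ K → ∣ K ∣ ≡ m × (∀ {z} → z ∈ F → lookup K z ≡ false)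

avoid : ∀ {n} (F : Subset n) m → ∣ F ∣ + m ≤ n → Avoiding F m
avoid {n} F zero _ = ∅ , ∣⊥∣≡0 n , λ {z} _ → lookup-replicate z false
avoid [] (suc m) ()
avoid (true ∷ F) (suc m) (s≤s room) with avoid F (suc m) room
... | K , ∣K∣≡m , K∩F≡∅ = false ∷ K , ∣K∣≡m , λ { here → refl ; (there z∈F) → K∩F≡∅ z∈F }
avoid {suc n} (false ∷ F) (suc m) room with avoid F m (≤-pred (subst (_≤ suc n) (+-suc ∣ F ∣ m) room))
... | K , ∣K∣≡m , K∩F≡∅ = true ∷ K , cong suc ∣K∣≡m , λ { (there z∈F) → K∩F≡∅ z∈F }

EmptyGraph : ∀ {n} → (Fin n → Fin n → Bool) → Set
EmptyGraph G = ∀ x y → x ≢ y → G x y ≡ false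

CompleteGraph : ∀ {n} → (Fin n → Fin n → Bool) → Set
CompleteGraph G = ∀ x y → x ≢ y → G x y ≡ true

emptyOrComplete : ∀ {m} (G : Fin (2 + m) → Fin (2 + m) → Bool) →
  (∀ {x y a b} → x ≢ y → a ≢ b → G x y ≡ G a b) → EmptyGraph G ⊎ CompleteGraph G
emptyOrComplete G uniform with G zero (suc zero) in g01
... | false = inj₁ (λ x y x≢y → trans (uniform x≢y (λ ())) g01)
... | true = inj₂ (λ x y x≢y → trans (uniform x≢y (λ ())) g01)

module Graph {n : ℕ} (G : Fin n → Fin n → Bool)
  (symG : ∀ x y → G x y ≡ G y x) (irrG : ∀ x → G x x ≡ false) where

  deg : Subset n → Fin n → ℕ
  deg K x = sum (λ y → 𝟙 K y * ⟦ G x y ⟧)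

  inK : Subset n → Fin n → Fin n → Bool
  inK K x y = lookup K x ∧ (lookup K y ∧ G x y)

  -- The order on Fin n that e↾ uses to pick one orientation of each edge.
  below : Fin n → Fin n → Bool
  below x y = does (x <? y)

  inK-sym : ∀ K x y → inK K y x ≡ inK K x y
  inK-sym K x y rewrite symG y x with lookup K x | lookup K y
  ... | true | true = refl
  ... | true | false = refl
  ... | false | true = refl
  ... | false | false = refl

  inK-diag : ∀ K x → inK K x x ≡ false
  inK-diag K x rewrite irrG x with lookup K x
  ... | true = refl
  ... | false = refl

  orient : ∀ K x y → ⟦ inK K x y ⟧ ≡ ⟦ below x y ∧ inK K x y ⟧ + ⟦ below y x ∧ inK K y x ⟧
  orient K x y with <-cmp x y
  ... | tri< x<y _ y≮x rewrite dec-true (x <? y) x<y | dec-false (y <? x) y≮x = sym (+-identityʳ _)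
  ... | tri> x≮y _ y<x rewrite dec-false (x <? y) x≮y | dec-true (y <? x) y<x | inK-sym K x y = refl
  ... | tri≈ _ refl _ rewrite inK-diag K x | ∧-zeroʳ (below x x) = refl

  e↾-as-sum : ∀ K → e↾ G K ≡ sum (λ x → sum (λ y → ⟦ below x y ∧ inK K x y ⟧))
  e↾-as-sum K =
    trans (count-concatMap id (λ x → map (λ y → (x , y)) (allFin n)) (isEdgeIn G K))
          (sum-cong-≗ (λ x → count-map id (λ y → (x , y)) (isEdgeIn G K)))

  handshake : ∀ K → e↾ G K + e↾ G K ≡ sum (λ x → 𝟙 K x * deg K x)
  handshake K = begin
    e↾ G K + e↾ G K                              ≡⟨ cong₂ _+_ (e↾-as-sum K) (e↾-as-sum K) ⟩
    S + S                                        ≡⟨ cong (S +_) (∑-comm A) ⟩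
    S + sum (λ x → sum (λ y → A y x))            ≡⟨ ∑-distrib-+ (λ x → sum (A x)) (λ x → sum (λ y → A y x)) ⟨
    sum (λ x → sum (A x) + sum (λ y → A y x))    ≡⟨ sum-cong-≗ (λ x → ∑-distrib-+ (A x) (λ y → A y x)) ⟨
    sum (λ x → sum (λ y → A x y + A y x))        ≡⟨ sum-cong-≗ (λ x → sum-cong-≗ (λ y → orient K x y)) ⟨
    sum (λ x → sum (λ y → ⟦ inK K x y ⟧))        ≡⟨ sum-cong-≗ (λ x → sum-cong-≗ (λ y → factor x y)) ⟩
    sum (λ x → sum (λ y → 𝟙 K x * (𝟙 K y * ⟦ G x y ⟧)))
                                                 ≡⟨ sum-cong-≗ (λ x → *-distribˡ-sum (𝟙 K x) (λ y → 𝟙 K y * ⟦ G x y ⟧)) ⟨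
    sum (λ x → 𝟙 K x * deg K x) ∎
    where
    open ≡-Reasoning
    A : Fin n → Fin n → ℕ
    A x y = ⟦ below x y ∧ inK K x y ⟧
    S = sum (λ x → sum (A x))
    factor : ∀ x y → ⟦ inK K x y ⟧ ≡ 𝟙 K x * (𝟙 K y * ⟦ G x y ⟧)
    factor x y = trans (⟦∧⟧ (lookup K x) _) (cong (𝟙 K x *_) (⟦∧⟧ (lookup K y) (G x y)))

  deg-∪ : ∀ K {w} → lookup K w ≡ false → ∀ x → deg (K ∪ ⁅ w ⁆) x ≡ deg K x + ⟦ G x w ⟧
  deg-∪ K w∉K x = ∑-∪⁅⁆ K w∉K (λ y → ⟦ G x y ⟧)

  e-∪ : ∀ K {w} → lookup K w ≡ false → e↾ G (K ∪ ⁅ w ⁆) ≡ e↾ G K + deg K w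
  e-∪ K {w} w∉K = half (begin
    e↾ G K′ + e↾ G K′                                        ≡⟨ handshake K′ ⟩
    sum (λ x → 𝟙 K′ x * deg K′ x)                            ≡⟨ sum-cong-≗ (λ x → cong (𝟙 K′ x *_) (deg-∪ K w∉K x)) ⟩
    sum (λ x → 𝟙 K′ x * (deg K x + ⟦ G x w ⟧))               ≡⟨ ∑-∪⁅⁆ K w∉K (λ x → deg K x + ⟦ G x w ⟧) ⟩
    sum (λ x → 𝟙 K x * (deg K x + ⟦ G x w ⟧)) + (deg K w + ⟦ G w w ⟧)
      ≡⟨ cong₂ _+_ (trans (sum-cong-≗ (λ x → *-distribˡ-+ (𝟙 K x) (deg K x) _))
                          (∑-distrib-+ (λ x → 𝟙 K x * deg K x) (λ x → 𝟙 K x * ⟦ G x w ⟧)))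
                   (cong (λ b → deg K w + ⟦ b ⟧) (irrG w)) ⟩
    (sum (λ x → 𝟙 K x * deg K x) + sum (λ x → 𝟙 K x * ⟦ G x w ⟧)) + (deg K w + 0)
      ≡⟨ cong₂ (λ s t → (s + t) + (deg K w + 0)) (sym (handshake K)) neighboursOfw ⟩
    ((e↾ G K + e↾ G K) + deg K w) + (deg K w + 0)            ≡⟨ regroup (e↾ G K) (deg K w) ⟩
    (e↾ G K + deg K w) + (e↾ G K + deg K w) ∎)
    where
    open ≡-Reasoning
    K′ = K ∪ ⁅ w ⁆
    neighboursOfw : sum (λ x → 𝟙 K x * ⟦ G x w ⟧) ≡ deg K w
    neighboursOfw = sum-cong-≗ (λ x → cong (λ b → 𝟙 K x * ⟦ b ⟧) (symG x w))
    half : ∀ {a b} → a + a ≡ b + b → a ≡ b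
    half {a} {b} eq = *-cancelˡ-≡ a b 2 (trans (cong (a +_) (+-identityʳ a)) (trans eq (cong (b +_) (sym (+-identityʳ b)))))
    regroup : ∀ e d → ((e + e) + d) + (d + 0) ≡ (e + d) + (e + d)
    regroup = solve-∀

  e-∪₂ : ∀ R {u w} → lookup R u ≡ false → lookup R w ≡ false → w ≢ u →
    e↾ G ((R ∪ ⁅ u ⁆) ∪ ⁅ w ⁆) ≡ (e↾ G R + deg R u) + (deg R w + ⟦ G w u ⟧)
  e-∪₂ R {u} {w} u∉R w∉R w≢u = begin
    e↾ G ((R ∪ ⁅ u ⁆) ∪ ⁅ w ⁆)               ≡⟨ e-∪ (R ∪ ⁅ u ⁆) (∉-∪⁅⁆ R w∉R w≢u) ⟩
    e↾ G (R ∪ ⁅ u ⁆) + deg (R ∪ ⁅ u ⁆) w     ≡⟨ cong₂ _+_ (e-∪ R u∉R) (deg-∪ R u∉R w) ⟩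
    (e↾ G R + deg R u) + (deg R w + ⟦ G w u ⟧) ∎
    where open ≡-Reasoning

  complete-deg : CompleteGraph G → ∀ K x → deg K x + 𝟙 K x ≡ ∣ K ∣
  complete-deg complete K x = begin
    deg K x + 𝟙 K x                                   ≡⟨ cong (deg K x +_) (∑-point x (𝟙 K)) ⟨
    deg K x + sum (λ y → 𝟙 ⁅ x ⁆ y * 𝟙 K y)            ≡⟨ ∑-distrib-+ (λ y → 𝟙 K y * ⟦ G x y ⟧) _ ⟨
    sum (λ y → 𝟙 K y * ⟦ G x y ⟧ + 𝟙 ⁅ x ⁆ y * 𝟙 K y)  ≡⟨ sum-cong-≗ (λ y → trans (cong (𝟙 K y * ⟦ G x y ⟧ +_) (*-comm (𝟙 ⁅ x ⁆ y) (𝟙 K y)))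
                                                                                (sym (*-distribˡ-+ (𝟙 K y) _ _))) ⟩
    sum (λ y → 𝟙 K y * (⟦ G x y ⟧ + 𝟙 ⁅ x ⁆ y))        ≡⟨ ∑-over K _ 1 (λ y _ → neighbourOrSelf y) ⟩
    ∣ K ∣ * 1                                         ≡⟨ *-identityʳ ∣ K ∣ ⟩
    ∣ K ∣ ∎
    where
    open ≡-Reasoning
    neighbourOrSelf : ∀ y → ⟦ G x y ⟧ + 𝟙 ⁅ x ⁆ y ≡ 1
    neighbourOrSelf y rewrite lookup-⁅⁆ x y with y ≟ x
    ... | yes refl rewrite irrG y = refl
    ... | no y≢x rewrite complete x y (≢-sym y≢x) = refl

  complete-count : CompleteGraph G → ∀ K c → ∣ K ∣ ≡ suc c → e↾ G K + e↾ G K ≡ suc c * c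
  complete-count complete K c ∣K∣≡1+c = begin
    e↾ G K + e↾ G K               ≡⟨ handshake K ⟩
    sum (λ x → 𝟙 K x * deg K x)   ≡⟨ ∑-over K (deg K) c degree ⟩
    ∣ K ∣ * c                     ≡⟨ cong (_* c) ∣K∣≡1+c ⟩
    suc c * c ∎
    where
    open ≡-Reasoning
    degree : ∀ x → lookup K x ≡ true → deg K x ≡ c
    degree x x∈K = suc-injective (begin
      suc (deg K x)        ≡⟨ +-comm 1 (deg K x) ⟩
      deg K x + 1          ≡⟨ cong (λ b → deg K x + ⟦ b ⟧) x∈K ⟨
      deg K x + 𝟙 K x      ≡⟨ complete-deg complete K x ⟩
      ∣ K ∣                ≡⟨ ∣K∣≡1+c ⟩
      suc c ∎)

  deg-pair : ∀ S x y → (∀ s → lookup S s ≡ true → ⟦ G x s ⟧ + ⟦ G y s ⟧ ≡ 1) → deg S x + deg S y ≡ ∣ S ∣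
  deg-pair S x y exactlyOne = begin
    deg S x + deg S y                                 ≡⟨ ∑-distrib-+ (λ s → 𝟙 S s * ⟦ G x s ⟧) _ ⟨
    sum (λ s → 𝟙 S s * ⟦ G x s ⟧ + 𝟙 S s * ⟦ G y s ⟧)  ≡⟨ sum-cong-≗ (λ s → *-distribˡ-+ (𝟙 S s) _ _) ⟨
    sum (λ s → 𝟙 S s * (⟦ G x s ⟧ + ⟦ G y s ⟧))        ≡⟨ ∑-over S _ 1 exactlyOne ⟩
    ∣ S ∣ * 1                                          ≡⟨ *-identityʳ ∣ S ∣ ⟩
    ∣ S ∣ ∎
    where open ≡-Reasoning

-- Congruences of natural numbers, stated without subtraction:
-- s ≡ t (mod p) when a common shift makes both divisible by p.
SameResidue : ℕ → ℕ → ℕ → Set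
SameResidue p s t = ∃ λ N → (p ∣ N + s) × (p ∣ N + t)

residue-cancel : ∀ {p} s t → SameResidue p (s + t) s → p ∣ t
residue-cancel {p} s t (N , p∣N+s+t , p∣N+s) = ∣m+n∣m⇒∣n (subst (p ∣_) (sym (+-assoc N s t)) p∣N+s+t) p∣N+s

residue-two : ∀ s t → SameResidue 2 s t → 2 ∣ s + t
residue-two s t (N , 2∣N+s , 2∣N+t) = ∣m+n∣m⇒∣n (subst (2 ∣_) (regroup N s t) (∣m∣n⇒∣m+n 2∣N+s 2∣N+t)) (divides N refl)
  where
  regroup : ∀ N s t → (N + s) + (N + t) ≡ N * 2 + (s + t)
  regroup = solve-∀

prime∤1 : ∀ {p} → Prime p → ¬ p ∣ 1
prime∤1 {p} p-prime p∣1 = nonTrivial⇒≢1 {{prime⇒nonTrivial p-prime}} (∣1⇒≡1 p∣1)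

prime-2-or-≥3 : ∀ {p} → Prime p → p ≡ 2 ⊎ 3 ≤ p
prime-2-or-≥3 {0} 0-prime = ⊥-elim (¬prime[0] 0-prime)
prime-2-or-≥3 {1} 1-prime = ⊥-elim (¬prime[1] 1-prime)
prime-2-or-≥3 {2} _ = inj₁ refl
prime-2-or-≥3 {suc (suc (suc _))} _ = inj₂ (s≤s (s≤s (s≤s z≤n)))

prime∤consecutive : ∀ {p} m → Prime p → p ∣ suc m → ¬ p ∣ m
prime∤consecutive {p} m p-prime p∣1+m p∣m = prime∤1 p-prime (∣m+n∣m⇒∣n (subst (p ∣_) (+-comm 1 m) p∣1+m) p∣m)

residue-bits : ∀ {p} → Prime p → ∀ α β → SameResidue p (1 + ⟦ β ⟧) ⟦ α ⟧ →
  (⟦ α ⟧ + ⟦ β ⟧ ≡ 1) × (3 ≤ p → α ≡ true × β ≡ false)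
residue-bits p-prime true false _ = refl , λ _ → refl , refl
residue-bits p-prime true true r = ⊥-elim (prime∤1 p-prime (residue-cancel 1 1 r))
residue-bits p-prime false false r = ⊥-elim (prime∤1 p-prime (residue-cancel 0 1 r))
residue-bits p-prime false true r = refl , λ 3≤p → ⊥-elim (p≰2 3≤p (∣⇒≤ (residue-cancel 0 2 r)))
  where
  p≰2 : ∀ {p} → 3 ≤ p → ¬ p ≤ 2
  p≰2 (s≤s (s≤s (s≤s _))) (s≤s (s≤s ()))

-- The rigidity argument.  G is a symmetric irreflexive graph on n
-- vertices, the subset size is k = 2 + j with k + 2 ≤ n, and every
-- k-subset spans a number of edges divisible by the prime p.

module Rigidity {n : ℕ} (G : Fin n → Fin n → Bool)
  (symG : ∀ x y → G x y ≡ G y x) (irrG : ∀ x → G x x ≡ false)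
  {p : ℕ} (p-prime : Prime p) (j : ℕ) (room : 4 + j ≤ n)
  (divisible : ∀ K → ∣ K ∣ ≡ 2 + j → p ∣ e↾ G K) where

  open Graph G symG irrG

  onePoint : ∀ S → ∣ S ∣ ≡ 1 + j → ∀ {w} → lookup S w ≡ false → p ∣ e↾ G S + deg S w
  onePoint S ∣S∣≡k-1 w∉S =
    subst (p ∣_) (e-∪ S w∉S) (divisible (S ∪ ⁅ _ ⁆) (trans (∣∪⁅⁆∣ S w∉S) (cong suc ∣S∣≡k-1)))

  twoPoints : ∀ R → ∣ R ∣ ≡ j → ∀ {u w} → lookup R u ≡ false → lookup R w ≡ false → w ≢ u →
    p ∣ (e↾ G R + deg R u) + (deg R w + ⟦ G w u ⟧)
  twoPoints R ∣R∣≡k-2 {u} {w} u∉R w∉R w≢u =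
    subst (p ∣_) (e-∪₂ R u∉R w∉R w≢u) (divisible ((R ∪ ⁅ u ⁆) ∪ ⁅ w ⁆) size)
    where
    size : ∣ (R ∪ ⁅ u ⁆) ∪ ⁅ w ⁆ ∣ ≡ 2 + j
    size = trans (∣∪⁅⁆∣ (R ∪ ⁅ u ⁆) (∉-∪⁅⁆ R w∉R w≢u)) (cong suc (trans (∣∪⁅⁆∣ R u∉R) (cong suc ∣R∣≡k-2)))

  -- Four-point congruence: complete a (k-2)-set R avoiding x, y, a, b by
  -- {a,x}, {b,y} and by {a,y}, {b,x}; both sums of edge counts are ≡ 0.
  fourPoint : ∀ {x y a b} → x ≢ a → x ≢ b → y ≢ a → y ≢ b →
    SameResidue p (⟦ G x a ⟧ + ⟦ G y b ⟧) (⟦ G y a ⟧ + ⟦ G x b ⟧)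
  fourPoint {x} {y} {a} {b} x≢a x≢b y≢a y≢b = fromR (avoid F j fits)
    where
    F : Subset n
    F = (⁅ x ⁆ ∪ ⁅ y ⁆) ∪ (⁅ a ⁆ ∪ ⁅ b ⁆)
    fits : ∣ F ∣ + j ≤ n
    fits = ≤-trans (+-monoˡ-≤ j (≤-trans (∣∪∣≤ (⁅ x ⁆ ∪ ⁅ y ⁆) (⁅ a ⁆ ∪ ⁅ b ⁆))
                                         (+-mono-≤ (∣⁅x,y⁆∣≤2 x y) (∣⁅x,y⁆∣≤2 a b)))) room
    regroup : ∀ A da db dx dy g h → ((A + da) + (dx + g)) + ((A + db) + (dy + h))
                                    ≡ (((A + da) + dx) + ((A + db) + dy)) + (g + h)
    regroup = solve-∀
    regroup′ : ∀ A da db dx dy g h → ((A + da) + (dy + g)) + ((A + db) + (dx + h))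
                                     ≡ (((A + da) + dx) + ((A + db) + dy)) + (g + h)
    regroup′ = solve-∀
    fromR : Avoiding F j → SameResidue p (⟦ G x a ⟧ + ⟦ G y b ⟧) (⟦ G y a ⟧ + ⟦ G x b ⟧)
    fromR (R , ∣R∣≡j , avoids) =
      N ,
      subst (p ∣_) (regroup A (deg R a) (deg R b) (deg R x) (deg R y) (⟦ G x a ⟧) (⟦ G y b ⟧))
        (∣m∣n⇒∣m+n (twoPoints R ∣R∣≡j a∉R x∉R x≢a) (twoPoints R ∣R∣≡j b∉R y∉R y≢b)) ,
      subst (p ∣_) (regroup′ A (deg R a) (deg R b) (deg R x) (deg R y) (⟦ G y a ⟧) (⟦ G x b ⟧))
        (∣m∣n⇒∣m+n (twoPoints R ∣R∣≡j a∉R y∉R y≢a) (twoPoints R ∣R∣≡j b∉R x∉R x≢b))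
      where
      x∉R : lookup R x ≡ false
      x∉R = avoids (x∈p∪q⁺ (inj₁ (x∈p∪q⁺ (inj₁ (x∈⁅x⁆ x)))))
      y∉R : lookup R y ≡ false
      y∉R = avoids (x∈p∪q⁺ (inj₁ (x∈p∪q⁺ (inj₂ (x∈⁅x⁆ y)))))
      a∉R : lookup R a ≡ false
      a∉R = avoids (x∈p∪q⁺ (inj₂ (x∈p∪q⁺ (inj₁ (x∈⁅x⁆ a)))))
      b∉R : lookup R b ≡ false
      b∉R = avoids (x∈p∪q⁺ (inj₂ (x∈p∪q⁺ (inj₂ (x∈⁅x⁆ b)))))
      A N : ℕ
      A = e↾ G R
      N = ((A + deg R a) + deg R x) + ((A + deg R b) + deg R y)

  propagate : ∀ {x y a} → x ≢ a → y ≢ a → G x a ≡ true → G y a ≡ false →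
    ∀ b → x ≢ b → y ≢ b → (⟦ G x b ⟧ + ⟦ G y b ⟧ ≡ 1) × (3 ≤ p → G x b ≡ true × G y b ≡ false)
  propagate {x} {y} x≢a y≢a xa ya b x≢b y≢b =
    residue-bits p-prime (G x b) (G y b)
      (subst₂ (SameResidue p) (cong (λ g → ⟦ g ⟧ + ⟦ G y b ⟧) xa) (cong (λ g → ⟦ g ⟧ + ⟦ G x b ⟧) ya)
        (fourPoint x≢a x≢b y≢a y≢b))

  -- Adding x, resp. y, to S gives
  -- deg_S x ≡ deg_S y (mod p) while deg_S x + deg_S y = k - 1, and for
  -- p ≥ 3 even deg_S x = k - 1, deg_S y = 0.  Either way p ∣ k - 1.
  splitForces : ∀ {x y} S → ∣ S ∣ ≡ 1 + j → lookup S x ≡ false → lookup S y ≡ false →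
    (∀ s → lookup S s ≡ true → (⟦ G x s ⟧ + ⟦ G y s ⟧ ≡ 1) × (3 ≤ p → G x s ≡ true × G y s ≡ false)) →
    p ∣ 1 + j
  splitForces {x} {y} S ∣S∣≡k-1 x∉S y∉S split = byPrime (prime-2-or-≥3 p-prime)
    where
    residue : SameResidue p (deg S x) (deg S y)
    residue = e↾ G S , onePoint S ∣S∣≡k-1 x∉S , onePoint S ∣S∣≡k-1 y∉S
    byPrime : p ≡ 2 ⊎ 3 ≤ p → p ∣ 1 + j
    byPrime (inj₁ p≡2) = subst (_∣ 1 + j) (sym p≡2)
      (subst (2 ∣_) (trans (deg-pair S x y (λ s s∈S → proj₁ (split s s∈S))) ∣S∣≡k-1)
        (residue-two (deg S x) (deg S y) (subst (λ q → SameResidue q (deg S x) (deg S y)) p≡2 residue)))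
    byPrime (inj₂ 3≤p) = residue-cancel 0 (1 + j) (subst₂ (SameResidue p) deg-x deg-y residue)
      where
      deg-x : deg S x ≡ 1 + j
      deg-x = trans (∑-over S _ 1 (λ s s∈S → cong ⟦_⟧ (proj₁ (proj₂ (split s s∈S) 3≤p))))
                    (trans (*-identityʳ ∣ S ∣) ∣S∣≡k-1)
      deg-y : deg S y ≡ 0
      deg-y = trans (∑-over S _ 0 (λ s s∈S → cong ⟦_⟧ (proj₂ (proj₂ (split s s∈S) 3≤p)))) (*-zeroʳ ∣ S ∣)

  -- Hence no vertex a can separate x from y when p ∤ k - 1: propagate the
  -- split to a (k-1)-set avoiding x, y.
  noSplit : ¬ p ∣ 1 + j → ∀ {x y a} → x ≢ a → y ≢ a → G x a ≡ true → G y a ≡ false → ⊥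
  noSplit p∤k-1 {x} {y} x≢a y≢a xa ya = fromS (avoid (⁅ x ⁆ ∪ ⁅ y ⁆) (1 + j) fits)
    where
    fits : ∣ ⁅ x ⁆ ∪ ⁅ y ⁆ ∣ + (1 + j) ≤ n
    fits = ≤-trans (+-monoˡ-≤ (1 + j) (∣⁅x,y⁆∣≤2 x y)) (≤-trans (n≤1+n (3 + j)) room)
    fromS : Avoiding (⁅ x ⁆ ∪ ⁅ y ⁆) (1 + j) → ⊥
    fromS (S , ∣S∣≡k-1 , avoids) =
      p∤k-1 (splitForces S ∣S∣≡k-1 x∉S y∉S
               (λ s s∈S → propagate x≢a y≢a xa ya s (outside s∈S x∉S) (outside s∈S y∉S)))
      where
      x∉S : lookup S x ≡ false
      x∉S = avoids (x∈p∪q⁺ (inj₁ (x∈⁅x⁆ x)))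
      y∉S : lookup S y ≡ false
      y∉S = avoids (x∈p∪q⁺ (inj₂ (x∈⁅x⁆ y)))
      outside : ∀ {s z} → lookup S s ≡ true → lookup S z ≡ false → z ≢ s
      outside s∈S z∉S refl with trans (sym s∈S) z∉S
      ... | ()

  sameNeighbour : ¬ p ∣ 1 + j → ∀ {x y a} → x ≢ a → y ≢ a → G x a ≡ G y a
  sameNeighbour p∤k-1 {x} {y} {a} x≢a y≢a with G x a in xa | G y a in ya
  ... | true | true = refl
  ... | false | false = refl
  ... | true | false = ⊥-elim (noSplit p∤k-1 x≢a y≢a xa ya)
  ... | false | true = ⊥-elim (noSplit p∤k-1 y≢a x≢a ya xa)

  uniform : ¬ p ∣ 1 + j → ∀ {x y a b} → x ≢ y → a ≢ b → G x y ≡ G a b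
  uniform p∤k-1 {x} {y} {a} {b} x≢y a≢b with a ≟ y
  ... | no a≢y = begin
    G x y ≡⟨ sameNeighbour p∤k-1 x≢y a≢y ⟩
    G a y ≡⟨ symG a y ⟩
    G y a ≡⟨ sameNeighbour p∤k-1 (≢-sym a≢y) (≢-sym a≢b) ⟩
    G b a ≡⟨ symG b a ⟩
    G a b ∎
    where open ≡-Reasoning
  ... | yes refl with b ≟ x
  ...   | yes refl = symG x y
  ...   | no b≢x = begin
    G x y ≡⟨ symG x y ⟩
    G y x ≡⟨ sameNeighbour p∤k-1 (≢-sym x≢y) b≢x ⟩
    G b x ≡⟨ symG b x ⟩
    G x b ≡⟨ sameNeighbour p∤k-1 (≢-sym b≢x) a≢b ⟩
    G y b ∎
    where open ≡-Reasoning

  notComplete : (∀ e → e + e ≡ (2 + j) * (1 + j) → ¬ p ∣ e) → ¬ CompleteGraph G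
  notComplete p∤halfProduct complete = fromK (avoid ∅ (2 + j) fits)
    where
    fits : ∣ ∅ {n} ∣ + (2 + j) ≤ n
    fits = subst (_≤ n) (cong (_+ (2 + j)) (sym (∣⊥∣≡0 n))) (≤-trans (m≤n+m (2 + j) 2) room)
    fromK : Avoiding ∅ (2 + j) → ⊥
    fromK (K , ∣K∣≡k , _) = p∤halfProduct (e↾ G K) (complete-count complete K (1 + j) ∣K∣≡k) (divisible K ∣K∣≡k)

prime∤halfProduct : ∀ {p} k e → Prime p → ¬ p ∣ suc k → ¬ p ∣ k → e + e ≡ suc k * k → ¬ p ∣ e
prime∤halfProduct {p} k e p-prime p∤k+1 p∤k 2e≡ p∣e =
  [ p∤k+1 , p∤k ]′ (euclidsLemma (suc k) k p-prime (subst (p ∣_) 2e≡ (∣m∣n⇒∣m+n p∣e p∣e)))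

halfProduct-odd : ∀ k e → k % 4 ≡ 2 → e + e ≡ k * (k ∸ 1) → ¬ 2 ∣ e
halfProduct-odd k e k%4≡2 2e≡ (divides q e≡q*2) = 4∤2 (∣m+n∣m⇒∣n 4∣4t+2 (n∣m*n t))
  where
  r t : ℕ
  r = k / 4
  t = 3 * r + 4 * r * r
  k≡2+4r : k ≡ 2 + r * 4
  k≡2+4r = trans (m≡m%n+[m/n]*n k 4) (cong (_+ r * 4) k%4≡2)
  expand : ∀ r → (2 + r * 4) * (1 + r * 4) ≡ (3 * r + 4 * r * r) * 4 + 2
  expand = solve-∀
  double : ∀ q → q * 2 + q * 2 ≡ q * 4
  double = solve-∀
  4∣4t+2 : 4 ∣ t * 4 + 2
  4∣4t+2 = divides q (begin
    t * 4 + 2                   ≡⟨ expand r ⟨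
    (2 + r * 4) * (1 + r * 4)   ≡⟨ cong (λ m → m * (m ∸ 1)) k≡2+4r ⟨
    k * (k ∸ 1)                 ≡⟨ 2e≡ ⟨
    e + e                       ≡⟨ cong₂ _+_ e≡q*2 e≡q*2 ⟩
    q * 2 + q * 2               ≡⟨ double q ⟩
    q * 4 ∎)
    where open ≡-Reasoning
  4∤2 : ¬ 4 ∣ 2
  4∤2 4∣2 with ∣⇒≤ 4∣2
  ... | s≤s (s≤s ())

-- k ≡ 0, 2 (mod 4) makes k even, hence k - 1 odd.
pred-odd : ∀ m → suc m % 4 ≡ 0 ⊎ suc m % 4 ≡ 2 → ¬ 2 ∣ m
pred-odd m k%4 = prime∤consecutive m prime[2]
  (m%n≡0⇒n∣m (suc m) 2 (trans (sym (m∣n⇒o%n%m≡o%m 2 4 (suc m) (divides 2 refl))) (mod2 k%4)))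
  where
  mod2 : suc m % 4 ≡ 0 ⊎ suc m % 4 ≡ 2 → suc m % 4 % 2 ≡ 0
  mod2 (inj₁ k%4≡0) = cong (_% 2) k%4≡0
  mod2 (inj₂ k%4≡2) = cong (_% 2) k%4≡2

module _ {v : ℕ} (T T' : Tournament v) where

  -- T ∔ T' is a simple graph: symmetric since reversing both arcs keeps
  -- their (dis)agreement, and without loops.
  boolSum-sym : ∀ x y → boolSumAdj T T' x y ≡ boolSumAdj T T' y x
  boolSum-sym x y with x ≟ y
  ... | yes refl = refl
  ... | no x≢y rewrite tournament T x y x≢y | tournament T' x y x≢y = xor-annihilates-not (arc T y x) (arc T' y x)

  boolSum-irr : ∀ x → boolSumAdj T T' x x ≡ false
  boolSum-irr x rewrite irreflexive T x | irreflexive T' x = refl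

  recover : ∀ x y → arc T' x y ≡ arc T x y xor boolSumAdj T T' x y
  recover x y with arc T x y | arc T' x y
  ... | true | true = refl
  ... | true | false = refl
  ... | false | true = refl
  ... | false | false = refl

  empty⇒same : EmptyGraph (boolSumAdj T T') → T' ≈T T
  empty⇒same empty x y with x ≟ y
  ... | yes refl rewrite irreflexive T x | irreflexive T' x = refl
  ... | no x≢y rewrite recover x y | empty x y x≢y = xor-identityʳ (arc T x y)

  complete⇒dual : CompleteGraph (boolSumAdj T T') → IsDualOf T' T
  complete⇒dual complete x y with x ≟ y
  ... | yes refl rewrite irreflexive T x | irreflexive T' x = refl
  ... | no x≢y rewrite recover x y | complete x y x≢y =
    trans (xor-comm (arc T x y) true) (sym (tournament T y x (≢-sym x≢y)))

theorem5p1 : (v p k : ℕ) → (T T' : Tournament v) → Prime p →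
    2 ≤ k → k ≤ v ∸ 2 →
    ((K : Subset v) → ∣ K ∣ ≡ k → p ∣ e↾ (boolSumAdj T T') K) →
    ((3 ≤ p → ¬ (p ∣ k) → ¬ (p ∣ k ∸ 1) → T' ≈T T)
    × (3 ≤ p → p ∣ k → (T' ≈T T) ⊎ IsDualOf T' T)
    × (p ≡ 2 → k % 4 ≡ 2 → T' ≈T T)
    × (p ≡ 2 → k % 4 ≡ 0 → (T' ≈T T) ⊎ IsDualOf T' T))
theorem5p1 v p 0 T T' p-prime () k≤v-2 divisible
theorem5p1 v p 1 T T' p-prime (s≤s ()) k≤v-2 divisible
theorem5p1 0 p (suc (suc j)) T T' p-prime 2≤k () divisible
theorem5p1 1 p (suc (suc j)) T T' p-prime 2≤k () divisible
theorem5p1 (suc (suc v)) p (suc (suc j)) T T' p-prime _ k≤v-2 divisible =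
  case-1 , case-2 , case-3 , case-4
  where
  G : Fin (suc (suc v)) → Fin (suc (suc v)) → Bool
  G = boolSumAdj T T'
  open Rigidity G (boolSum-sym T T') (boolSum-irr T T') p-prime j (s≤s (s≤s k≤v-2)) divisible

  sameOrComplete : ¬ p ∣ suc j → T' ≈T T ⊎ CompleteGraph G
  sameOrComplete p∤k-1 = map₁ (empty⇒same T T') (emptyOrComplete G (uniform p∤k-1))

  sameOrDual : ¬ p ∣ suc j → T' ≈T T ⊎ IsDualOf T' T
  sameOrDual p∤k-1 = map₂ (complete⇒dual T T') (sameOrComplete p∤k-1)

  same : ¬ p ∣ suc j → (∀ e → e + e ≡ suc (suc j) * suc j → ¬ p ∣ e) → T' ≈T T
  same p∤k-1 p∤halfProduct =
    [ id , (λ complete → ⊥-elim (notComplete p∤halfProduct complete)) ]′ (sameOrComplete p∤k-1)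

  case-1 : 3 ≤ p → ¬ p ∣ suc (suc j) → ¬ p ∣ suc j → T' ≈T T
  case-1 _ p∤k p∤k-1 = same p∤k-1 (λ e → prime∤halfProduct (suc j) e p-prime p∤k p∤k-1)

  case-2 : 3 ≤ p → p ∣ suc (suc j) → T' ≈T T ⊎ IsDualOf T' T
  case-2 _ p∣k = sameOrDual (prime∤consecutive (suc j) p-prime p∣k)

  case-3 : p ≡ 2 → suc (suc j) % 4 ≡ 2 → T' ≈T T
  case-3 refl k%4≡2 = same (pred-odd (suc j) (inj₂ k%4≡2)) (λ e → halfProduct-odd (suc (suc j)) e k%4≡2)

  case-4 : p ≡ 2 → suc (suc j) % 4 ≡ 0 → T' ≈T T ⊎ IsDualOf T' T
  case-4 refl k%4≡0 = sameOrDual (pred-odd (suc j) (inj₁ k%4≡0))
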